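{- Let $\lambda\in\mathbb{R}$. For all integers $m,n\ge 0$, \[ \mathrm{Bel}_{n+m,\lambda}(x)= \sum_{k=0}^{n}\sum_{j=0}^{m}\binom{n}{k}S_{2,\lambda}(m,j)\,\mathrm{Bel}_{k,\lambda}(x)\,(j-m\lambda)_{n-k,\lambda}\,x^{j}. \]
   Context: For $\lambda\in\mathbb{R}$, $(x)_{0,\lambda}=1$ and $(x)_{n,\lambda}=x(x-\lambda)\cdots(x-(n-1)\lambda)$ for $n\ge1$; $(x)_0=1$ and $(x)_n=x(x-1)\cdots(x-n+1)$. The degenerate Stirling numbers of the second kind $S_{2,\lambda}(n,k)$ are defined by $(x)_{n,\lambda}=\sum_{k=0}^{n}S_{2,\lambda}(n,k)(x)_{k}$. The degenerate exponential is $e_\lambda(t)=\sum_{k\ge0}(1)_{k,\lambda}t^k/k!$, and the degenerate Bell polynomials are defined by $e^{x(e_{\lambda}(t)-1)}=\sum_{n=0}^{\infty}\mathrm{Bel}_{n,\lambda}(x)\frac{t^{n}}{n!}$ (equivalently $\mathrm{Bel}_{n,\lambda}(x)=\sum_{k=0}^nS_{2,\lambda}(n,k)x^k$). -}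

module Defs where

open import Level using (Level)
open import Algebra.Bundles using (CommutativeRing)
open import Data.Nat using (ℕ; zero; suc)
open import Data.Nat.Combinatorics using (_C_)

module _ {c ℓ : Level} (R : CommutativeRing c ℓ) where
  open CommutativeRing R hiding (zero)

  ι : ℕ → Carrier
  ι zero    = 0#
  ι (suc n) = 1# + ι n

  sumTo : ℕ → (ℕ → Carrier) → Carrier
  sumTo zero    f = f zero
  sumTo (suc n) f = sumTo n f + f (suc n)

  pow : Carrier → ℕ → Carrier
  pow x zero    = 1#
  pow x (suc n) = pow x n * x

  dfall : Carrier → Carrier → ℕ → Carrier
  dfall lam x zero    = 1#
  dfall lam x (suc n) = dfall lam x n * (x - ι n * lam)

  fall : Carrier → ℕ → Carrier
  fall x n = dfall 1# x n

  -- degenerate Stirling numbers of the second kind S_{2,lam}(n,k),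
  -- via the recurrence equivalent to (x)_{n,lam} = Σ_k S_{2,lam}(n,k) (x)_k:
  -- S(n+1,k) = S(n,k-1) + (k - n lam) S(n,k),  S(0,0)=1, S(0,k+1)=0, S(n+1,0)=0.
  S2 : Carrier → ℕ → ℕ → Carrier
  S2 lam zero    zero    = 1#
  S2 lam zero    (suc k) = 0#
  S2 lam (suc n) zero    = 0#
  S2 lam (suc n) (suc k) = S2 lam n k + (ι (suc k) - ι n * lam) * S2 lam n (suc k)

  Bel : Carrier → ℕ → Carrier → Carrier
  Bel lam n x = sumTo n (λ k → S2 lam n k * pow x k)

  binom : ℕ → ℕ → Carrier
  binom n k = ι (n C k)

{-# OPTIONS --safe #-}
-- Read a polynomial through its coefficient sequence.  The Stirling recurrence says that the
-- coefficients of Bel_{n+1,λ} arise from those of Bel_{n,λ} by the operator p ↦ x p + x p′ − nλ p,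
-- and Pascal's rule together with (a)_{r+1,λ} = (a)_{r,λ} (a − rλ) shows that the coefficients of
-- Σ_k C(n,k) (a)_{n−k,λ} Bel_{k,λ}(x) obey the same recurrence with −nλ replaced by a − nλ.
-- Multiplying by x^j shifts the constant of that operator by j.  So, starting from
-- Bel_{m,λ}(x) = Σ_j S_{2,λ}(m,j) x^j and applying the operator n times, the monomial x^j grows
-- into x^j Σ_k C(n,k) (j − mλ)_{n−k,λ} Bel_{k,λ}(x).
module Submission where

open import Algebra.Bundles using (CommutativeRing)
open import Data.Nat as ℕ using (ℕ; zero; suc; _∸_; _≤_; _<_; _≤′_; ≤′-reflexive; ≤′-step; z≤n; s≤s)
import Data.Nat.Properties as ℕₚ
open import Data.Nat.Combinatorics using (_C_; nCk+nC[k+1]≡[n+1]C[k+1]; k>n⇒nCk≡0)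
open import Function.Base using (_∘_)
import Relation.Binary.PropositionalEquality as ≡

open import Defs

module DegenerateBell {r₁ r₂} (R : CommutativeRing r₁ r₂) where
  open CommutativeRing R hiding (zero)
  open import Algebra.Properties.CommutativeSemigroup +-commutativeSemigroup using (interchange; x∙yz≈y∙xz)
  open import Relation.Binary.Reasoning.Setoid setoid
  open import Algebra.Properties.AbelianGroup +-abelianGroup using (⁻¹-∙-comm)
  open import Algebra.Solver.Ring.NaturalCoefficients.Default commutativeSemiring

  ∑ : ℕ → (ℕ → Carrier) → Carrier
  ∑ = sumTo R

  syntax ∑ n (λ k → f) = ∑[ k ≤ n ] f

  ∑-cong≤ : ∀ n {f g : ℕ → Carrier} → (∀ i → i ≤ n → f i ≈ g i) → ∑ n f ≈ ∑ n g
  ∑-cong≤ zero    f≈g = f≈g 0 z≤n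
  ∑-cong≤ (suc n) f≈g =
    +-cong (∑-cong≤ n (λ i i≤n → f≈g i (ℕₚ.m≤n⇒m≤1+n i≤n))) (f≈g (suc n) ℕₚ.≤-refl)

  ∑-cong : ∀ n {f g : ℕ → Carrier} → (∀ i → f i ≈ g i) → ∑ n f ≈ ∑ n g
  ∑-cong n f≈g = ∑-cong≤ n (λ i _ → f≈g i)

  ∑-zero : ∀ n {f : ℕ → Carrier} → (∀ i → i ≤ n → f i ≈ 0#) → ∑ n f ≈ 0#
  ∑-zero zero    f≈0 = f≈0 0 z≤n
  ∑-zero (suc n) f≈0 =
    trans (+-cong (∑-zero n (λ i i≤n → f≈0 i (ℕₚ.m≤n⇒m≤1+n i≤n))) (f≈0 (suc n) ℕₚ.≤-refl))
          (+-identityʳ 0#)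

  ∑-+ : ∀ n (f g : ℕ → Carrier) → ∑[ i ≤ n ] (f i + g i) ≈ ∑ n f + ∑ n g
  ∑-+ zero    f g = refl
  ∑-+ (suc n) f g = trans (+-congʳ (∑-+ n f g)) (interchange _ _ _ _)

  ∑-*ˡ : ∀ n a (f : ℕ → Carrier) → a * ∑ n f ≈ ∑[ i ≤ n ] (a * f i)
  ∑-*ˡ zero    a f = refl
  ∑-*ˡ (suc n) a f = trans (distribˡ a _ _) (+-congʳ (∑-*ˡ n a f))

  ∑-*ʳ : ∀ n a (f : ℕ → Carrier) → ∑ n f * a ≈ ∑[ i ≤ n ] (f i * a)
  ∑-*ʳ zero    a f = refl
  ∑-*ʳ (suc n) a f = trans (distribʳ a _ _) (+-congʳ (∑-*ʳ n a f))

  ∑-swap : ∀ n m (f : ℕ → ℕ → Carrier) → ∑[ i ≤ n ] ∑[ j ≤ m ] f i j ≈ ∑[ j ≤ m ] ∑[ i ≤ n ] f i j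
  ∑-swap zero    m f = refl
  ∑-swap (suc n) m f =
    trans (+-congʳ (∑-swap n m f)) (sym (∑-+ m (λ j → ∑[ i ≤ n ] f i j) (f (suc n))))

  ∑-peel : ∀ n (f : ℕ → Carrier) → ∑ (suc n) f ≈ f 0 + ∑[ i ≤ n ] f (suc i)
  ∑-peel zero    f = refl
  ∑-peel (suc n) f = trans (+-congʳ (∑-peel n f)) (+-assoc _ _ _)

  ∑-truncate : ∀ {n N} (f : ℕ → Carrier) → n ≤ N → (∀ i → n < i → f i ≈ 0#) → ∑ N f ≈ ∑ n f
  ∑-truncate {n} f n≤N f≈0 = go (ℕₚ.≤⇒≤′ n≤N)
    where
    go : ∀ {N} → n ≤′ N → ∑ N f ≈ ∑ n f
    go (≤′-reflexive ≡.refl) = refl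
    go (≤′-step n≤′N)        =
      trans (+-cong (go n≤′N) (f≈0 _ (s≤s (ℕₚ.≤′⇒≤ n≤′N)))) (+-identityʳ _)

  ι-+ : ∀ a b → ι R (a ℕ.+ b) ≈ ι R a + ι R b
  ι-+ zero    b = sym (+-identityˡ _)
  ι-+ (suc a) b = trans (+-congˡ (ι-+ a b)) (sym (+-assoc _ _ _))

  ι-suc-+ : ∀ k c → ι R (suc k) + c ≈ ι R k + (1# + c)
  ι-suc-+ k c = trans (+-assoc _ _ _) (x∙yz≈y∙xz _ _ _)

  -ι-+* : ∀ a b l → - (ι R (a ℕ.+ b) * l) ≈ - (ι R a * l) + - (ι R b * l)
  -ι-+* a b l = trans (-‿cong (trans (*-congʳ (ι-+ a b)) (distribʳ l _ _))) (sym (⁻¹-∙-comm _ _))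

  binom-pascal : ∀ n k → binom R (suc n) (suc k) ≈ binom R n k + binom R n (suc k)
  binom-pascal n k =
    trans (reflexive (≡.cong (ι R) (≡.sym (nCk+nC[k+1]≡[n+1]C[k+1] n k)))) (ι-+ (n C k) (n C suc k))

  ∑-binomial-suc : ∀ n (b v : ℕ → Carrier) →
    ∑[ k ≤ suc n ] (binom R (suc n) k * b (suc n ∸ k) * v k)
      ≈ ∑[ k ≤ n ] (binom R n k * b (n ∸ k) * v (suc k))
        + ∑[ k ≤ n ] (binom R n k * b (suc n ∸ k) * v k)
  ∑-binomial-suc n b v = begin
    ∑ (suc n) T                            ≈⟨ ∑-peel n T ⟩
    T 0 + ∑[ k ≤ n ] T (suc k)             ≈⟨ +-congˡ (trans (∑-cong n T-split) (∑-+ n A (B ∘ suc))) ⟩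
    T 0 + (∑ n A + ∑[ k ≤ n ] B (suc k))   ≈⟨ x∙yz≈y∙xz _ _ _ ⟩
    ∑ n A + (B 0 + ∑[ k ≤ n ] B (suc k))   ≈⟨ +-congˡ (sym (∑-peel n B)) ⟩
    ∑ n A + (∑ n B + B (suc n))            ≈⟨ +-congˡ (trans (+-congˡ B-top) (+-identityʳ _)) ⟩
    ∑ n A + ∑ n B                          ∎
    where
    T A B : ℕ → Carrier
    T k = binom R (suc n) k * b (suc n ∸ k) * v k
    A k = binom R n k * b (n ∸ k) * v (suc k)
    B k = binom R n k * b (suc n ∸ k) * v k

    T-split : ∀ k → T (suc k) ≈ A k + B (suc k)
    T-split k = trans (*-congʳ (*-congʳ (binom-pascal n k)))
                      (trans (*-congʳ (distribʳ _ _ _)) (distribʳ _ _ _))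

    B-top : B (suc n) ≈ 0#
    B-top = trans (*-congʳ (trans (*-congʳ (reflexive (≡.cong (ι R) (k>n⇒nCk≡0 (ℕₚ.n<1+n n))))) (zeroˡ _)))
                  (zeroˡ _)

  Seq : Set r₁
  Seq = ℕ → Carrier

  infix 4 _≋_
  _≋_ : Seq → Seq → Set r₂
  f ≋ g = ∀ i → f i ≈ g i

  -- f : Seq stands for the polynomial Σ_i f i x^i; unit is 1 and shift j multiplies by x^j.
  unit : Seq
  unit zero    = 1#
  unit (suc i) = 0#

  shift : ℕ → Seq → Seq
  shift zero    f i       = f i
  shift (suc j) f zero    = 0#
  shift (suc j) f (suc i) = shift j f i

  shift-cong : ∀ j {f g} → f ≋ g → shift j f ≋ shift j g
  shift-cong zero    f≋g i       = f≋g i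
  shift-cong (suc j) f≋g zero    = refl
  shift-cong (suc j) f≋g (suc i) = shift-cong j f≋g i

  shift-suc : ∀ j f → shift (suc j) f ≋ shift 1 (shift j f)
  shift-suc j f zero    = refl
  shift-suc j f (suc i) = refl

  shift-vanishes : ∀ j {n f} → (∀ i → n < i → f i ≈ 0#) → ∀ i → j ℕ.+ n < i → shift j f i ≈ 0#
  shift-vanishes zero    f≈0 i       n<i       = f≈0 i n<i
  shift-vanishes (suc j) f≈0 (suc i) (s≤s j+n<i) = shift-vanishes j f≈0 i j+n<i

  ∑-shift-unit : ∀ m (f : Seq) → (∀ i → m < i → f i ≈ 0#) →
    (λ i → ∑[ j ≤ m ] (f j * shift j unit i)) ≋ f
  ∑-shift-unit zero    f f≈0 zero    = *-identityʳ _
  ∑-shift-unit zero    f f≈0 (suc i) = trans (zeroʳ _) (sym (f≈0 (suc i) (s≤s z≤n)))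
  ∑-shift-unit (suc m) f f≈0 zero    = begin
    ∑[ j ≤ suc m ] (f j * shift j unit 0)     ≈⟨ ∑-peel m _ ⟩
    f 0 * 1# + ∑[ j ≤ m ] (f (suc j) * 0#)   ≈⟨ +-cong (*-identityʳ _) (∑-zero m (λ j _ → zeroʳ _)) ⟩
    f 0 + 0#                                ≈⟨ +-identityʳ _ ⟩
    f 0                                     ∎
  ∑-shift-unit (suc m) f f≈0 (suc i) = begin
    ∑[ j ≤ suc m ] (f j * shift j unit (suc i))          ≈⟨ ∑-peel m _ ⟩
    f 0 * 0# + ∑[ j ≤ m ] (f (suc j) * shift j unit i)   ≈⟨ +-cong (zeroʳ _) (∑-shift-unit m (f ∘ suc) f∘suc≈0 i) ⟩
    0# + f (suc i)                                      ≈⟨ +-identityˡ _ ⟩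
    f (suc i)                                           ∎
    where
    f∘suc≈0 : ∀ j → m < j → f (suc j) ≈ 0#
    f∘suc≈0 j m<j = f≈0 (suc j) (s≤s m<j)

  evalPoly : ℕ → Seq → Carrier → Carrier
  evalPoly N f x = ∑[ i ≤ N ] (f i * pow R x i)

  evalPoly-linear : ∀ N m (w : ℕ → Carrier) (F : ℕ → Seq) x →
    evalPoly N (λ i → ∑[ j ≤ m ] (w j * F j i)) x ≈ ∑[ j ≤ m ] (w j * evalPoly N (F j) x)
  evalPoly-linear N m w F x = begin
    ∑[ i ≤ N ] (∑[ j ≤ m ] (w j * F j i) * pow R x i)
      ≈⟨ ∑-cong N (λ i → ∑-*ʳ m _ _) ⟩
    ∑[ i ≤ N ] ∑[ j ≤ m ] (w j * F j i * pow R x i)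
      ≈⟨ ∑-swap N m _ ⟩
    ∑[ j ≤ m ] ∑[ i ≤ N ] (w j * F j i * pow R x i)
      ≈⟨ ∑-cong m (λ j → trans (∑-cong N (λ i → *-assoc _ _ _)) (sym (∑-*ˡ N _ _))) ⟩
    ∑[ j ≤ m ] (w j * evalPoly N (F j) x) ∎

  evalPoly-truncate : ∀ {n N} f x → n ≤ N → (∀ i → n < i → f i ≈ 0#) → evalPoly N f x ≈ evalPoly n f x
  evalPoly-truncate f x n≤N f≈0 = ∑-truncate _ n≤N (λ i n<i → trans (*-congʳ (f≈0 i n<i)) (zeroˡ _))

  evalPoly-shift : ∀ j N f x → evalPoly (j ℕ.+ N) (shift j f) x ≈ pow R x j * evalPoly N f x
  evalPoly-shift zero    N f x = sym (*-identityˡ _)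
  evalPoly-shift (suc j) N f x = begin
    evalPoly (suc j ℕ.+ N) (shift (suc j) f) x
      ≈⟨ ∑-peel (j ℕ.+ N) _ ⟩
    0# * 1# + ∑[ i ≤ j ℕ.+ N ] (shift j f i * (pow R x i * x))
      ≈⟨ +-cong (zeroˡ _) (∑-cong (j ℕ.+ N) (λ i → sym (*-assoc _ _ _))) ⟩
    0# + ∑[ i ≤ j ℕ.+ N ] (shift j f i * pow R x i * x)
      ≈⟨ trans (+-identityˡ _) (sym (∑-*ʳ (j ℕ.+ N) x _)) ⟩
    evalPoly (j ℕ.+ N) (shift j f) x * x
      ≈⟨ *-congʳ (evalPoly-shift j N f x) ⟩
    pow R x j * evalPoly N f x * x
      ≈⟨ solve 3 (λ p e y → p :* e :* y := p :* y :* e) refl _ _ _ ⟩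
    pow R x (suc j) * evalPoly N f x ∎

  evalPoly-shift-≤ : ∀ j {n N f} x → (∀ i → n < i → f i ≈ 0#) → j ℕ.+ n ≤ N →
    evalPoly N (shift j f) x ≈ pow R x j * evalPoly n f x
  evalPoly-shift-≤ j {n} {f = f} x f≈0 j+n≤N =
    trans (evalPoly-truncate (shift j f) x j+n≤N (shift-vanishes j f≈0)) (evalPoly-shift j n f x)

  -- bellStep c acts on coefficients as the operator p ↦ x p + x p′ + c p.
  bellStep : Carrier → Seq → Seq
  bellStep c f i = shift 1 f i + (ι R i + c) * f i

  bellStep-cong : ∀ {c d f g} → c ≈ d → f ≋ g → bellStep c f ≋ bellStep d g
  bellStep-cong c≈d f≋g i = +-cong (shift-cong 1 f≋g i) (*-cong (+-congˡ c≈d) (f≋g i))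

  bellStep-+ : ∀ c d f → bellStep (c + d) f ≋ λ i → bellStep c f i + d * f i
  bellStep-+ c d f i =
    solve 5 (λ s k c d y → s :+ (k :+ (c :+ d)) :* y := s :+ (k :+ c) :* y :+ d :* y) refl _ _ _ _ _

  bellStep-linear : ∀ m c (w : ℕ → Carrier) (F : ℕ → Seq) →
    bellStep c (λ i → ∑[ j ≤ m ] (w j * F j i)) ≋ λ i → ∑[ j ≤ m ] (w j * bellStep c (F j) i)
  bellStep-linear m c w F i = begin
    shift 1 G i + (ι R i + c) * G i
      ≈⟨ +-cong (shift-linear i) (∑-*ˡ m _ _) ⟩
    ∑[ j ≤ m ] (w j * shift 1 (F j) i) + ∑[ j ≤ m ] ((ι R i + c) * (w j * F j i))
      ≈⟨ sym (∑-+ m _ _) ⟩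
    ∑[ j ≤ m ] (w j * shift 1 (F j) i + (ι R i + c) * (w j * F j i))
      ≈⟨ ∑-cong m (λ j → solve 4 (λ w s e y → w :* s :+ e :* (w :* y) := w :* (s :+ e :* y)) refl _ _ _ _) ⟩
    ∑[ j ≤ m ] (w j * bellStep c (F j) i) ∎
    where
    G : Seq
    G i = ∑[ j ≤ m ] (w j * F j i)
    shift-linear : shift 1 G ≋ λ i → ∑[ j ≤ m ] (w j * shift 1 (F j) i)
    shift-linear zero    = sym (∑-zero m (λ j _ → zeroʳ _))
    shift-linear (suc i) = refl

  bellStep-shift : ∀ j c f → bellStep c (shift j f) ≋ shift j (bellStep (ι R j + c) f)
  bellStep-shift zero    c f i       = bellStep-cong (sym (+-identityˡ c)) (λ _ → refl) i
  bellStep-shift (suc j) c f zero    = trans (+-identityˡ _) (zeroʳ _)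
  bellStep-shift (suc j) c f (suc i) = begin
    shift (suc j) f i + (ι R (suc i) + c) * shift j f i
      ≈⟨ +-cong (shift-suc j f i) (*-congʳ (ι-suc-+ i c)) ⟩
    bellStep (1# + c) (shift j f) i
      ≈⟨ bellStep-shift j (1# + c) f i ⟩
    shift j (bellStep (ι R j + (1# + c)) f) i
      ≈⟨ shift-cong j (bellStep-cong (sym (ι-suc-+ j c)) (λ _ → refl)) i ⟩
    shift j (bellStep (ι R (suc j) + c) f) i ∎

  module _ (lam : Carrier) where

    S : ℕ → Seq
    S = S2 R lam

    S2-vanishes : ∀ {k s} → k < s → S k s ≈ 0#
    S2-vanishes {zero}  {suc s} _         = refl
    S2-vanishes {suc k} {suc s} (s≤s k<s) =
      trans (+-cong (S2-vanishes k<s) (trans (*-congˡ (S2-vanishes (ℕₚ.m<n⇒m<1+n k<s))) (zeroʳ _)))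
            (+-identityˡ 0#)

    S2-zero : S 0 ≋ unit
    S2-zero zero    = refl
    S2-zero (suc s) = refl

    S2-suc : ∀ k → S (suc k) ≋ bellStep (- (ι R k * lam)) (S k)
    S2-suc zero    zero    = sym (trans (+-identityˡ _) (trans (*-identityʳ _)
                               (trans (+-congˡ (-‿cong (zeroˡ lam))) (-‿inverseʳ 0#))))
    S2-suc (suc k) zero    = sym (trans (+-identityˡ _) (zeroʳ _))
    S2-suc k       (suc s) = refl

    -- The degenerate r-Stirling numbers of the second kind, for r = a:
    -- the coefficients of Σ_k C(n,k) (a)_{n-k,λ} Bel_{k,λ}(x).
    rS2 : Carrier → ℕ → Seq
    rS2 a n s = ∑[ k ≤ n ] (binom R n k * dfall R lam a (n ∸ k) * S k s)

    rS2-zero : ∀ a → rS2 a 0 ≋ unit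
    rS2-zero a s =
      trans (trans (*-congʳ (trans (*-identityʳ _) (+-identityʳ 1#))) (*-identityˡ _)) (S2-zero s)

    rS2-vanishes : ∀ a {n s} → n < s → rS2 a n s ≈ 0#
    rS2-vanishes a n<s =
      ∑-zero _ (λ k k≤n → trans (*-congˡ (S2-vanishes (ℕₚ.≤-<-trans k≤n n<s))) (zeroʳ _))

    rS2-suc : ∀ a n → rS2 a (suc n) ≋ bellStep (a - ι R n * lam) (rS2 a n)
    rS2-suc a n t = begin
      rS2 a (suc n) t
        ≈⟨ ∑-binomial-suc n D (λ k → S k t) ⟩
      ∑[ k ≤ n ] (w k * S (suc k) t) + ∑[ k ≤ n ] (binom R n k * D (suc n ∸ k) * S k t)
        ≈⟨ sym (∑-+ n _ _) ⟩
      ∑[ k ≤ n ] (w k * S (suc k) t + binom R n k * D (suc n ∸ k) * S k t)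
        ≈⟨ ∑-cong≤ n term-step ⟩
      ∑[ k ≤ n ] (w k * bellStep (a - ι R n * lam) (S k) t)
        ≈⟨ sym (bellStep-linear n _ w S t) ⟩
      bellStep (a - ι R n * lam) (rS2 a n) t ∎
      where
      D w : ℕ → Carrier
      D   = dfall R lam a
      w k = binom R n k * D (n ∸ k)

      coefficient : ∀ {k} → k ≤ n → - (ι R k * lam) + (a - ι R (n ∸ k) * lam) ≈ a - ι R n * lam
      coefficient {k} k≤n = sym (begin
        a + - (ι R n * lam)
          ≈⟨ +-congˡ (-‿cong (*-congʳ (reflexive (≡.cong (ι R) (≡.sym (ℕₚ.m+[n∸m]≡n k≤n)))))) ⟩
        a + - (ι R (k ℕ.+ (n ∸ k)) * lam)
          ≈⟨ +-congˡ (-ι-+* k (n ∸ k) lam) ⟩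
        a + (- (ι R k * lam) + - (ι R (n ∸ k) * lam))
          ≈⟨ x∙yz≈y∙xz _ _ _ ⟩
        - (ι R k * lam) + (a - ι R (n ∸ k) * lam) ∎)

      term-step : ∀ k → k ≤ n →
        w k * S (suc k) t + binom R n k * D (suc n ∸ k) * S k t ≈ w k * bellStep (a - ι R n * lam) (S k) t
      term-step k k≤n = begin
        w k * S (suc k) t + binom R n k * D (suc n ∸ k) * S k t
          ≈⟨ +-cong (*-congˡ (S2-suc k t)) (*-congʳ (*-congˡ (reflexive (≡.cong D (ℕₚ.+-∸-assoc 1 k≤n))))) ⟩
        binom R n k * D (n ∸ k) * bellStep (- (ι R k * lam)) (S k) t
          + binom R n k * (D (n ∸ k) * (a - ι R (n ∸ k) * lam)) * S k t
          ≈⟨ solve 5 (λ b d p e y → b :* d :* p :+ b :* (d :* e) :* y := b :* d :* (p :+ e :* y)) refl _ _ _ _ _ ⟩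
        w k * (bellStep (- (ι R k * lam)) (S k) t + (a - ι R (n ∸ k) * lam) * S k t)
          ≈⟨ *-congˡ (sym (bellStep-+ _ _ (S k) t)) ⟩
        w k * bellStep (- (ι R k * lam) + (a - ι R (n ∸ k) * lam)) (S k) t
          ≈⟨ *-congˡ (bellStep-cong (coefficient k≤n) (λ _ → refl) t) ⟩
        w k * bellStep (a - ι R n * lam) (S k) t ∎

    S2-+ : ∀ m n → S (n ℕ.+ m) ≋ λ i → ∑[ j ≤ m ] (S m j * shift j (rS2 (ι R j - ι R m * lam) n) i)
    S2-+ m zero    i = sym (begin
      ∑[ j ≤ m ] (S m j * shift j (rS2 (a j) 0) i)
        ≈⟨ ∑-cong m (λ j → *-congˡ (shift-cong j (rS2-zero (a j)) i)) ⟩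
      ∑[ j ≤ m ] (S m j * shift j unit i)
        ≈⟨ ∑-shift-unit m (S m) (λ _ → S2-vanishes) i ⟩
      S m i ∎)
      where
      a : ℕ → Carrier
      a j = ι R j - ι R m * lam
    S2-+ m (suc n) i = begin
      S (suc (n ℕ.+ m)) i
        ≈⟨ S2-suc (n ℕ.+ m) i ⟩
      bellStep c (S (n ℕ.+ m)) i
        ≈⟨ bellStep-cong refl (S2-+ m n) i ⟩
      bellStep c (λ i → ∑[ j ≤ m ] (S m j * shift j (rS2 (a j) n) i)) i
        ≈⟨ bellStep-linear m c (S m) (λ j → shift j (rS2 (a j) n)) i ⟩
      ∑[ j ≤ m ] (S m j * bellStep c (shift j (rS2 (a j) n)) i)
        ≈⟨ ∑-cong m (λ j → *-congˡ (trans (bellStep-shift j c _ i) (shift-cong j (rS2-step j) i))) ⟩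
      ∑[ j ≤ m ] (S m j * shift j (rS2 (a j) (suc n)) i) ∎
      where
      a : ℕ → Carrier
      a j = ι R j - ι R m * lam
      c : Carrier
      c = - (ι R (n ℕ.+ m) * lam)

      coefficient : ∀ j → ι R j + c ≈ a j - ι R n * lam
      coefficient j = begin
        ι R j + - (ι R (n ℕ.+ m) * lam)               ≈⟨ +-congˡ (trans (-ι-+* n m lam) (+-comm _ _)) ⟩
        ι R j + (- (ι R m * lam) + - (ι R n * lam))   ≈⟨ sym (+-assoc _ _ _) ⟩
        a j - ι R n * lam                             ∎

      rS2-step : ∀ j → bellStep (ι R j + c) (rS2 (a j) n) ≋ rS2 (a j) (suc n)
      rS2-step j s = trans (bellStep-cong (coefficient j) (λ _ → refl) s) (sym (rS2-suc (a j) n s))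

    evalPoly-rS2 : ∀ a n x →
      evalPoly n (rS2 a n) x ≈ ∑[ k ≤ n ] (binom R n k * dfall R lam a (n ∸ k) * Bel R lam k x)
    evalPoly-rS2 a n x =
      trans (evalPoly-linear n n _ S x)
            (∑-cong≤ n (λ k k≤n → *-congˡ (evalPoly-truncate (S k) x k≤n (λ _ → S2-vanishes))))

    Bel-+ : ∀ m n x →
      Bel R lam (n ℕ.+ m) x
        ≈ ∑[ j ≤ m ] (S m j * (pow R x j *
            ∑[ k ≤ n ] (binom R n k * dfall R lam (ι R j - ι R m * lam) (n ∸ k) * Bel R lam k x)))
    Bel-+ m n x = begin
      evalPoly (n ℕ.+ m) (S (n ℕ.+ m)) x
        ≈⟨ ∑-cong (n ℕ.+ m) (λ i → *-congʳ (S2-+ m n i)) ⟩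
      evalPoly (n ℕ.+ m) (λ i → ∑[ j ≤ m ] (S m j * shift j (rS2 (a j) n) i)) x
        ≈⟨ evalPoly-linear (n ℕ.+ m) m (S m) (λ j → shift j (rS2 (a j) n)) x ⟩
      ∑[ j ≤ m ] (S m j * evalPoly (n ℕ.+ m) (shift j (rS2 (a j) n)) x)
        ≈⟨ ∑-cong≤ m (λ j j≤m → *-congˡ (evalPoly-shifted j≤m)) ⟩
      ∑[ j ≤ m ] (S m j * (pow R x j * ∑[ k ≤ n ] (binom R n k * dfall R lam (a j) (n ∸ k) * Bel R lam k x))) ∎
      where
      a : ℕ → Carrier
      a j = ι R j - ι R m * lam

      evalPoly-shifted : ∀ {j} → j ≤ m →
        evalPoly (n ℕ.+ m) (shift j (rS2 (a j) n)) x
          ≈ pow R x j * ∑[ k ≤ n ] (binom R n k * dfall R lam (a j) (n ∸ k) * Bel R lam k x)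
      evalPoly-shifted {j} j≤m = begin
        evalPoly (n ℕ.+ m) (shift j (rS2 (a j) n)) x  ≈⟨ evalPoly-shift-≤ j x (λ _ → rS2-vanishes (a j)) j+n≤n+m ⟩
        pow R x j * evalPoly n (rS2 (a j) n) x         ≈⟨ *-congˡ (evalPoly-rS2 (a j) n x) ⟩
        pow R x j * ∑[ k ≤ n ] (binom R n k * dfall R lam (a j) (n ∸ k) * Bel R lam k x) ∎
        where
        j+n≤n+m : j ℕ.+ n ≤ n ℕ.+ m
        j+n≤n+m = ℕₚ.≤-trans (ℕₚ.+-monoˡ-≤ n j≤m) (ℕₚ.≤-reflexive (ℕₚ.+-comm m n))

open import Data.Nat using (_+_)

theorem12 : ∀ {c ℓ} (R : CommutativeRing c ℓ) (lam x : CommutativeRing.Carrier R) (m n : ℕ) →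
    CommutativeRing._≈_ R
      (Bel R lam (n + m) x)
      (sumTo R n (λ k → sumTo R m (λ j →
        CommutativeRing._*_ R
          (CommutativeRing._*_ R
            (CommutativeRing._*_ R
              (CommutativeRing._*_ R (binom R n k) (S2 R lam m j))
              (Bel R lam k x))
            (dfall R lam (CommutativeRing._-_ R (ι R j) (CommutativeRing._*_ R (ι R m) lam)) (n ∸ k)))
          (pow R x j))))
theorem12 R lam x m n = begin
  Bel R lam (n + m) x
    ≈⟨ Bel-+ lam m n x ⟩
  ∑[ j ≤ m ] (S2 R lam m j * (pow R x j * ∑[ k ≤ n ] (binom R n k * d j k * Bel R lam k x)))
    ≈⟨ ∑-cong m (λ j → trans (*-congˡ (∑-*ˡ n _ _)) (∑-*ˡ n _ _)) ⟩
  ∑[ j ≤ m ] ∑[ k ≤ n ] (S2 R lam m j * (pow R x j * (binom R n k * d j k * Bel R lam k x)))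
    ≈⟨ ∑-swap m n _ ⟩
  ∑[ k ≤ n ] ∑[ j ≤ m ] (S2 R lam m j * (pow R x j * (binom R n k * d j k * Bel R lam k x)))
    ≈⟨ ∑-cong n (λ k → ∑-cong m (λ j → rearrange _ _ _ _ _)) ⟩
  ∑[ k ≤ n ] ∑[ j ≤ m ] (binom R n k * S2 R lam m j * Bel R lam k x * d j k * pow R x j) ∎
  where
  open CommutativeRing R using (Carrier; _≈_; _*_; _-_; *-congˡ; refl; trans; setoid)
  open DegenerateBell R
  open import Relation.Binary.Reasoning.Setoid setoid
  open import Algebra.Solver.Ring.NaturalCoefficients.Default (CommutativeRing.commutativeSemiring R)
  d : ℕ → ℕ → Carrier
  d j k = dfall R lam (ι R j - ι R m * lam) (n ∸ k)
  rearrange : ∀ s p b d e → s * (p * (b * d * e)) ≈ b * s * e * d * p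
  rearrange = solve 5 (λ s p b d e → s :* (p :* (b :* d :* e)) := b :* s :* e :* d :* p) refl
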